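{- Let $H$ be a $2$-edge-connected undirected graph and $T$ a DFS tree of $H$ rooted at $r$. For every vertex $u\neq r$ let $S(u)=\{u\}\cup\{v\neq r \mid H\setminus\{(u,p(u)),(v,p(v))\} \text{ is not connected}\}$. Then for every vertex $u\neq r$ and every $v\in S(u)$, we have $S(v)=S(u)$.
   Context: $p(x)$ denotes the parent of $x$ in $T$, so $(x,p(x))$ is the tree-edge joining $x$ to its parent. $H\setminus\{e,e'\}$ is obtained by deleting the edges $e,e'$. -}

module Defs where

open import Data.Nat using (ℕ)
open import Data.Fin using (Fin)
open import Data.Product using (_×_)
open import Data.Sum using (_⊎_)
open import Relation.Nullary using (¬_)
open import Relation.Binary.PropositionalEquality using (_≡_; _≢_)
open import Relation.Binary.Construct.Closure.ReflexiveTransitive using (Star)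

record Graph (n : ℕ) : Set₁ where
  field
    Adj   : Fin n → Fin n → Set
    sym   : ∀ {x y} → Adj x y → Adj y x
    irrefl : ∀ {x} → ¬ Adj x x
open Graph public

SameEdge : ∀ {n} → Fin n → Fin n → Fin n → Fin n → Set
SameEdge x y a b = (x ≡ a × y ≡ b) ⊎ (x ≡ b × y ≡ a)

DelEdge : ∀ {n} → (Fin n → Fin n → Set) → Fin n → Fin n → Fin n → Fin n → Set
DelEdge A a b x y = A x y × ¬ SameEdge x y a b

Connected : ∀ {n} → (Fin n → Fin n → Set) → Set
Connected {n} A = (x y : Fin n) → Star A x y

TwoEdgeConnected : ∀ {n} → Graph n → Set
TwoEdgeConnected H =
  Connected (Adj H) × (∀ a b → Adj H a b → Connected (DelEdge (Adj H) a b))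

-- One step towards the root in the rooted tree with root r and parent map p
-- (the parent map is only used at non-root vertices).
ParentStep : ∀ {n} → Fin n → (Fin n → Fin n) → Fin n → Fin n → Set
ParentStep r p x y = x ≢ r × y ≡ p x

-- AncestorOf r p x y : y is an ancestor of x (x is a descendant of y), reflexively.
AncestorOf : ∀ {n} → Fin n → (Fin n → Fin n) → Fin n → Fin n → Set
AncestorOf r p = Star (ParentStep r p)

IsRootedSpanningTree : ∀ {n} → Graph n → Fin n → (Fin n → Fin n) → Set
IsRootedSpanningTree H r p =
  (∀ x → x ≢ r → Adj H x (p x)) × (∀ x → AncestorOf r p x r)

-- DFS tree: a rooted spanning tree in which every edge of H joins an
-- ancestor/descendant pair (no cross edges).
IsDFSTree : ∀ {n} → Graph n → Fin n → (Fin n → Fin n) → Set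
IsDFSTree H r p =
  IsRootedSpanningTree H r p ×
  (∀ x y → Adj H x y → AncestorOf r p x y ⊎ AncestorOf r p y x)

DelTwoTreeEdges : ∀ {n} → Graph n → (Fin n → Fin n) → Fin n → Fin n → Fin n → Fin n → Set
DelTwoTreeEdges H p u v = DelEdge (DelEdge (Adj H) u (p u)) v (p v)

InS : ∀ {n} → Graph n → Fin n → (Fin n → Fin n) → Fin n → Fin n → Set
InS H r p u v = v ≡ u ⊎ (v ≢ r × ¬ Connected (DelTwoTreeEdges H p u v))

module Submission where

-- Write  e ~ f  for "e = f, or deleting both edges e and f
-- disconnects H".  The theorem says that S(u) is the ~-class of the tree edge
-- (u, p u), so it suffices that ~ is an equivalence relation on tree edges.
-- Symmetry is immediate; the content is transitivity for distinct edges
-- e = cd, f = ab, g = gh of a 2-edge-connected graph G: if {e,f} and {f,g}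
-- are cut pairs, then so is {e,g}.  Let R and S be the components of the
-- vertex a in G∖{e,f} and in G∖{f,g}.  Neither contains b (otherwise G∖e,
-- resp. G∖g, would be connected), so, since G∖f is connected, R contains
-- exactly one endpoint of e, while S contains both (e is an edge of G∖{f,g}).
-- If G∖{e,g} were connected, walking from a along its edges would show that
-- R and S agree on every vertex -- contradicting the behaviour at c and d.

open import Defs
open import Data.Nat using (ℕ)
open import Data.Fin using (Fin; _≟_)
open import Data.Product using (_,_)
open import Data.Sum using (_⊎_; inj₁; inj₂)
open import Data.Empty using (⊥-elim)
open import Function using (id; _∘_)
open import Function.Bundles using (_⇔_; mk⇔; Equivalence)
open import Function.Properties.Equivalence using () renaming (sym to ⇔-sym; trans to ⇔-trans)
open import Relation.Nullary using (¬_; Dec; yes; no)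
open import Relation.Nullary.Decidable using (_×-dec_; _⊎-dec_)
open import Relation.Binary.PropositionalEquality using (_≡_; _≢_; refl) renaming (sym to ≡-sym)
open import Relation.Binary.Construct.Closure.ReflexiveTransitive
  using (Star; ε; _◅_; _◅◅_; gmap; reverse; _⋆)

transport : {I : Set} {T : I → I → Set} (P : I → Set) →
            (∀ {x y} → T x y → P x → P y) → ∀ {x y} → Star T x y → P x → P y
transport P step ε px = px
transport P step (t ◅ ts) px = transport P step ts (step t px)

snoc : {I : Set} {T : I → I → Set} {s x y : I} → Star T s x → T x y → Star T s y
snoc w t = w ◅◅ (t ◅ ε)

sameEdge? : ∀ {n} (x y a b : Fin n) → Dec (SameEdge x y a b)
sameEdge? x y a b = (x ≟ a ×-dec y ≟ b) ⊎-dec (x ≟ b ×-dec y ≟ a)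

SameEdge-flip : ∀ {n} {x y a b : Fin n} → SameEdge y x a b → SameEdge x y a b
SameEdge-flip (inj₁ (ya , xb)) = inj₂ (xb , ya)
SameEdge-flip (inj₂ (yb , xa)) = inj₁ (xa , yb)

module CutPairs {n : ℕ} (G : Fin n → Fin n → Set) (G-sym : ∀ {x y} → G x y → G y x) where

  Del2 : Fin n → Fin n → Fin n → Fin n → Fin n → Fin n → Set
  Del2 a b c d = DelEdge (DelEdge G a b) c d

  CutPair : Fin n → Fin n → Fin n → Fin n → Set
  CutPair a b c d = ¬ Connected (Del2 a b c d)

  Del2-sym : ∀ {a b c d x y} → Del2 a b c d x y → Del2 a b c d y x
  Del2-sym ((g , ¬ab) , ¬cd) = (G-sym g , ¬ab ∘ SameEdge-flip) , ¬cd ∘ SameEdge-flip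

  Del2-swap : ∀ {a b c d x y} → Del2 a b c d x y → Del2 c d a b x y
  Del2-swap ((g , ¬ab) , ¬cd) = (g , ¬cd) , ¬ab

  CutPair-sym : ∀ {a b c d} → CutPair a b c d → CutPair c d a b
  CutPair-sym cut k = cut λ x y → gmap id Del2-swap (k x y)

  -- If G ∖ cd is connected and the endpoints of ab remain joined in
  -- G ∖ {cd , ab}, then G ∖ {cd , ab} is connected: reroute every use of ab.
  reconnect : ∀ {a b c d} → Connected (DelEdge G c d) →
              Star (Del2 c d a b) a b → Connected (Del2 c d a b)
  reconnect {a} {b} {c} {d} k detour x y = (reroute ⋆) (k x y)
    where
    reroute : ∀ {x y} → DelEdge G c d x y → Star (Del2 c d a b) x y
    reroute {x} {y} (g , ¬cd) with sameEdge? x y a b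
    ... | yes (inj₁ (refl , refl)) = detour
    ... | yes (inj₂ (refl , refl)) = reverse Del2-sym detour
    ... | no ¬ab = ((g , ¬cd) , ¬ab) ◅ ε

  cut-separates : ∀ {a b c d} → Connected (DelEdge G c d) → CutPair c d a b →
                  ¬ Star (Del2 c d a b) a b
  cut-separates k cut detour = cut (reconnect k detour)

  -- If G ∖ ab is connected and the component of a in G ∖ {cd , ab} contains
  -- either both or neither of c and d, then it also contains b:
  -- every use of the edge cd on a walk from a to b can be skipped.
  straddle : ∀ {a b c d} → Connected (DelEdge G a b) →
             (Star (Del2 c d a b) a c ⇔ Star (Del2 c d a b) a d) →
             Star (Del2 c d a b) a b
  straddle {a} {b} {c} {d} k c⇔d = transport (Star (Del2 c d a b) a) step (k a b) ε
    where
    step : ∀ {x y} → DelEdge G a b x y → Star (Del2 c d a b) a x → Star (Del2 c d a b) a y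
    step {x} {y} (g , ¬ab) with sameEdge? x y c d
    ... | yes (inj₁ (refl , refl)) = Equivalence.to c⇔d
    ... | yes (inj₂ (refl , refl)) = Equivalence.from c⇔d
    ... | no ¬cd = λ w → snoc w ((g , ¬cd) , ¬ab)

  CutPair-trans : ∀ {a b c d g h} → G c d →
                  Connected (DelEdge G c d) → Connected (DelEdge G a b) →
                  Connected (DelEdge G g h) →
                  ¬ SameEdge c d a b → ¬ SameEdge c d g h →
                  CutPair c d a b → CutPair a b g h → CutPair c d g h
  CutPair-trans {a} {b} {c} {d} {g} {h} cd kcd kab kgh cd≢ab cd≢gh cut₁ cut₂ K =
    cut-separates kcd cut₁ (straddle kab R-c⇔d)
    where
    R S : Fin n → Set
    R = Star (Del2 c d a b) a
    S = Star (Del2 a b g h) a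

    ¬Rb : ¬ R b
    ¬Rb = cut-separates kcd cut₁

    ¬Sb : ¬ S b
    ¬Sb = cut-separates kgh (CutPair-sym cut₂) ∘ gmap id Del2-swap

    -- An edge of G ∖ {cd , gh} preserves the agreement of R and S:
    -- ab leads into b, which neither contains; any other edge lies in both graphs.
    agree-step : ∀ {x y} → Del2 c d g h x y → R x ⇔ S x → R y ⇔ S y
    agree-step {x} {y} ((e , ¬cd) , ¬gh) with sameEdge? x y a b
    ... | yes (inj₁ (refl , refl)) = λ _ → mk⇔ (⊥-elim ∘ ¬Rb) (⊥-elim ∘ ¬Sb)
    ... | yes (inj₂ (refl , refl)) = λ _ → mk⇔ (λ _ → ε) (λ _ → ε)
    ... | no ¬ab = λ x-agrees → mk⇔
            (λ ry → snoc (Equivalence.to x-agrees (snoc ry (Del2-sym eR))) eS)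
            (λ sy → snoc (Equivalence.from x-agrees (snoc sy (Del2-sym eS))) eR)
      where
      eR : Del2 c d a b x y
      eR = (e , ¬cd) , ¬ab
      eS : Del2 a b g h x y
      eS = (e , ¬ab) , ¬gh

    agree : ∀ x → R x ⇔ S x
    agree x = transport (λ z → R z ⇔ S z) agree-step (K a x) (mk⇔ (λ _ → ε) (λ _ → ε))

    S-c⇔d : S c ⇔ S d
    S-c⇔d = mk⇔ (λ s → snoc s ecd) (λ s → snoc s (Del2-sym ecd))
      where
      ecd : Del2 a b g h c d
      ecd = (cd , cd≢ab) , cd≢gh

    R-c⇔d : R c ⇔ R d
    R-c⇔d = ⇔-trans (agree c) (⇔-trans S-c⇔d (⇔-sym (agree d)))

closed-avoids-root : ∀ {n} {r : Fin n} {p : Fin n → Fin n} (C : Fin n → Set) →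
                     (∀ {x} → C x → x ≢ r) → (∀ {x} → C x → C (p x)) →
                     ∀ {z} → C z → ¬ AncestorOf r p z r
closed-avoids-root {r = r} {p} C C-nonRoot C-closed cz path =
  C-nonRoot (transport C step path cz) refl
  where
  step : ∀ {x y} → ParentStep r p x y → C x → C y
  step (_ , refl) = C-closed

-- In a rooted tree, distinct non-root vertices have distinct parent edges:
-- otherwise x and y would be each other's parents, a cycle missing the root.
parentEdges-distinct : ∀ {n} {r : Fin n} {p : Fin n → Fin n} →
                       (∀ x → AncestorOf r p x r) →
                       ∀ {x y} → x ≢ y → x ≢ r → y ≢ r → ¬ SameEdge x (p x) y (p y)
parentEdges-distinct reach x≢y _ _ (inj₁ (x≡y , _)) = x≢y x≡y
parentEdges-distinct {r = r} {p} reach {x} {y} _ x≢r y≢r (inj₂ (x≡py , px≡y)) =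
  closed-avoids-root twoCycle nonRoot closed (inj₁ refl) (reach x)
  where
  twoCycle : Fin _ → Set
  twoCycle z = z ≡ x ⊎ z ≡ y
  nonRoot : ∀ {z} → twoCycle z → z ≢ r
  nonRoot (inj₁ refl) = x≢r
  nonRoot (inj₂ refl) = y≢r
  closed : ∀ {z} → twoCycle z → twoCycle (p z)
  closed (inj₁ refl) = inj₂ px≡y
  closed (inj₂ refl) = inj₁ (≡-sym x≡py)

module CutClasses {n : ℕ} (H : Graph n) (r : Fin n) (p : Fin n → Fin n)
                  (bridgeless : ∀ a b → Adj H a b → Connected (DelEdge (Adj H) a b))
                  (tree : IsRootedSpanningTree H r p) where

  open CutPairs (Adj H) (Graph.sym H)

  private
    parentAdj : ∀ x → x ≢ r → Adj H x (p x)
    parentAdj = let (adj , _) = tree in adj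

    reachRoot : ∀ x → AncestorOf r p x r
    reachRoot = let (_ , reach) = tree in reach

    treeEdge-bridgeless : ∀ x → x ≢ r → Connected (DelEdge (Adj H) x (p x))
    treeEdge-bridgeless x x≢r = bridgeless x (p x) (parentAdj x x≢r)

  InS-nonRoot : ∀ {u v} → u ≢ r → InS H r p u v → v ≢ r
  InS-nonRoot u≢r (inj₁ refl) = u≢r
  InS-nonRoot _ (inj₂ (v≢r , _)) = v≢r

  InS-sym : ∀ {u v} → u ≢ r → InS H r p u v → InS H r p v u
  InS-sym _ (inj₁ refl) = inj₁ refl
  InS-sym u≢r (inj₂ (_ , cut)) = inj₂ (u≢r , CutPair-sym cut)

  InS-trans : ∀ {u v w} → u ≢ r → InS H r p u v → InS H r p v w → InS H r p u w
  InS-trans _ (inj₁ refl) v~w = v~w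
  InS-trans _ u~v (inj₁ refl) = u~v
  InS-trans {u} {v} {w} u≢r (inj₂ (v≢r , cut₁)) (inj₂ (w≢r , cut₂)) with w ≟ u | v ≟ u
  ... | yes w≡u | _ = inj₁ w≡u
  ... | no _ | yes refl = inj₂ (w≢r , cut₂)
  ... | no w≢u | no v≢u =
    inj₂ (w≢r , CutPair-trans (parentAdj u u≢r)
                  (treeEdge-bridgeless u u≢r) (treeEdge-bridgeless v v≢r)
                  (treeEdge-bridgeless w w≢r)
                  (parentEdges-distinct reachRoot (v≢u ∘ ≡-sym) u≢r v≢r)
                  (parentEdges-distinct reachRoot (w≢u ∘ ≡-sym) u≢r w≢r)
                  cut₁ cut₂)

proposition8 : (n : ℕ) (H : Graph n) (r : Fin n) (p : Fin n → Fin n) →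
    TwoEdgeConnected H → IsDFSTree H r p →
    (u : Fin n) → u ≢ r → (v : Fin n) → InS H r p u v →
    (w : Fin n) → InS H r p v w ⇔ InS H r p u w
proposition8 n H r p (_ , bridgeless) (tree , _) u u≢r v u~v w =
  mk⇔ (InS-trans u≢r u~v) (InS-trans (InS-nonRoot u≢r u~v) (InS-sym u≢r u~v))
  where open CutClasses H r p bridgeless tree
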